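{- Let $j$ be a non-negative integer. For every positive integer $n$, $p_{3,j+1}(n)$ equals the number of partitions of $n$ with rank $<j$.
   Context: A partition of $n$ is a finite multiset of positive integers summing to $n$. The rank of a partition is its largest part minus its number of parts. For positive integers $A,a$ and a partition $\pi$, $\mathrm{mex}_{A,a}(\pi)$ is the smallest element of $\{a,a+A,a+2A,\dots\}$ that is not a part of $\pi$. $p_{A,a}(n)$ is the number of partitions $\pi$ of $n$ with $\mathrm{mex}_{A,a}(\pi)\equiv a \pmod{2A}$. -}

module Defs where

open import Data.Nat using (ℕ; zero; suc; _+_; _*_; _≥_; _<_; _⊔_)
open import Data.Integer.Divisibility using (_∣_)
open import Data.Nat.Properties using (_≟_)
open import Data.Integer as ℤ using (ℤ; +_; _-_)
open import Data.List using (List; []; _∷_; length; foldr)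
open import Data.Nat.ListAction using (sum)
open import Data.List.Relation.Unary.All using (All)
open import Data.List.Relation.Unary.Linked using (Linked)
open import Data.List.Membership.DecPropositional _≟_ using (_∈?_)
open import Relation.Nullary.Decidable using (does)
open import Data.Bool using (if_then_else_)
open import Relation.Binary.PropositionalEquality using (_≡_)
open import Data.Product using (Σ)

-- A partition of n: a multiset of positive integers summing to n,
-- represented canonically as a non-increasing list.
record Partition (n : ℕ) : Set where
  constructor mkPartition
  field
    parts    : List ℕ
    nonincr  : Linked _≥_ parts
    positive : All (0 <_) parts
    sums     : sum parts ≡ n
open Partition public

largestPart : List ℕ → ℕ
largestPart = foldr _⊔_ 0

rank : ∀ {n} → Partition n → ℤ
rank π = + largestPart (parts π) - + length (parts π)

mexIdxFrom : ℕ → ℕ → ℕ → ℕ → List ℕ → ℕ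
mexIdxFrom zero     k A a ps = k
mexIdxFrom (suc fl) k A a ps =
  if does ((a + k * A) ∈? ps) then mexIdxFrom fl (suc k) A a ps else k

-- mex_{A,a}(ps): smallest element of {a, a+A, a+2A, ...} not in ps.
-- Fuel suc (length ps) suffices: at most length ps candidates can be parts.
mex : ℕ → ℕ → List ℕ → ℕ
mex A a ps = a + mexIdxFrom (suc (length ps)) 0 A a ps * A

MexCond : ℕ → ℕ → ∀ {n} → Partition n → Set
MexCond A a π = (+ (2 * A)) ∣ (+ mex A a (parts π) - + a)

-- Write E_a(n) and O_a(n) for the partitions of n whose mex_{3,a} is a + 3k with k even,
-- respectively odd, and R_j(n) and R̄_j(n) for those of rank < j, respectively ≥ j.
-- Deleting a part a lowers k by one, so O_a(a + r) ≅ E_{a+3}(r); replacing the largest part x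
-- by a first column of height x − j − 1 gives R̄_j(j + 1 + r) ≅ R_{j+3}(r). By induction on n,
-- E_{j+4}(r) ≅ R_{j+3}(r) for r < n, hence O_{j+1}(n) ≅ R̄_j(n), and as there are only finitely
-- many partitions of n, the complements E_{j+1}(n) and R_j(n) are in bijection too.
module Submission where

open import Defs
open import Data.Nat using (ℕ; suc; _≤_)
open import Data.Integer using (+_) renaming (_<_ to _<ℤ_)
open import Data.Product using (Σ)
open import Function.Bundles using (_↔_)

open import Data.Bool using (Bool; true; false; T; not; _∨_)
open import Data.Bool.Properties using (T-irrelevant; T-∨; ∨-inverseʳ; not-involutive)
open import Data.Empty using (⊥; ⊥-elim)
open import Data.Fin as Fin using (Fin)
open import Data.Fin.Permutation using (↔⇒≡)
open import Data.Fin.Properties using (+↔⊎; 1↔⊤)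
open import Data.Integer using (_-_; _⊖_; ∣_∣) renaming (_≤_ to _≤ℤ_)
import Data.Integer.Properties as ℤ
open import Data.Integer.Properties using (m-n≡m⊖n; ⊖-≥; ⊖-monoˡ-<; ⊖-monoˡ-≤)
open import Data.List using (List; []; _∷_; length; map; _++_; replicate; filter)
open import Data.List.Membership.Propositional using (_∈_; _∉_)
open import Data.List.Properties
  using (length-++; length-map; length-replicate; length-filter; map-++; map-∘; map-id; map-replicate;
         filter-++; filter-all; filter-none; ++-identityʳ)
open import Data.List.Relation.Binary.Permutation.Propositional
  using (_↭_; ↭-refl; ↭-prep; ↭-swap; ↭-trans; ↭-sym)
open import Data.List.Relation.Binary.Permutation.Propositional.Properties
  using (All-resp-↭; ∈-resp-↭; ↭-length)
open import Data.List.Relation.Unary.All as All using (All; []; _∷_)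
import Data.List.Relation.Unary.All.Properties as All
open import Data.List.Relation.Unary.All.Properties using (replicate⁺)
open import Data.List.Relation.Unary.Any using (here; there)
open import Data.List.Relation.Unary.Linked as Linked using (Linked; []; [-]; _∷_)
import Data.List.Relation.Unary.Linked.Properties as Linked
open import Data.List.Relation.Unary.Linked.Properties using (Linked⇒All)
open import Data.Nat
  using (NonZero; zero; pred; _+_; _*_; _∸_; _<_; _≥_; _≤ᵇ_; _≡ᵇ_; _<?_; z≤n; s≤s)
open import Data.Nat.Divisibility
  using (divides; ∣1⇒≡1; n∣n; ∣m∣n⇒∣m+n; ∣m+n∣m⇒∣n; *-cancelˡ-∣; *-monoˡ-∣)
  renaming (_∣_ to _ℕ∣_)
open import Data.Nat.Induction using (<-rec)
open import Data.Nat.ListAction using (sum)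
open import Data.Nat.ListAction.Properties using (sum-↭; sum-++)
open import Data.Nat.Properties
  using (_≟_; _≤?_; ≤-refl; ≤-reflexive; ≤-trans; ≤-antisym; ≤-pred; <-irrefl; <-≤-trans;
         <⇒≤; ≰⇒>; ≮⇒≥; ≤⇒≯; 1+n≰n; ≤-irrelevant; <-irrelevant; ≡-irrelevant;
         ≤ᵇ⇒≤; ≤⇒≤ᵇ; ≡ᵇ⇒≡; ≡⇒≡ᵇ; +-comm; +-assoc; +-suc; +-identityʳ;
         +-cancelˡ-≡; +-cancelʳ-≡; +-monoˡ-≤; m≤m+n; m≤n+m; m<m+n; *-comm; *-cancelʳ-≡;
         m+[n∸m]≡n; m+n∸m≡n; [m+n]∸[m+o]≡n∸o; m≤n⇒∃[o]m+o≡n; pred-mono-≤;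
         ⊔-lub; m≤m⊔n; m≤n⊔m; m≥n⇒m⊔n≡m; module ≤-Reasoning)
open import Data.List.Membership.DecPropositional _≟_ using (_∈?_)
open import Data.Nat.Tactic.RingSolver using (solve-∀)
open import Data.Product using (_,_; proj₁; ∃-syntax)
open import Data.Product.Function.Dependent.Propositional using (Σ-↔)
open import Data.Sum using (_⊎_; inj₁; inj₂; [_,_])
import Data.Sum as Sum
open import Data.Sum.Function.Propositional using (_⊎-↔_)
open import Data.Unit using (tt)
open import Function.Base using (_∘_)
open import Function.Bundles using (Inverse; Equivalence; _⇔_; mk↔ₛ′; mk⇔)
open import Function.Properties.Inverse using (↔-trans; ↔-sym; ↔-refl)
open import Relation.Binary.PropositionalEquality
  using (_≡_; _≢_; refl; sym; trans; cong; cong₂; subst; subst₂; module ≡-Reasoning)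
open import Relation.Nullary using (yes; no; ¬_; does; contradiction)
open import Relation.Nullary.Decidable
  using (⌊_⌋; dec-true; dec-false; does-⇔; toWitness; fromWitness;
         toWitnessFalse; fromWitnessFalse)

-- Finite types

Finite : Set → Set
Finite X = ∃[ n ] (X ↔ Fin n)

Subtype : {X : Set} → (X → Bool) → Set
Subtype {X} b = Σ X (T ∘ b)

subtype-≡ : {X : Set} {b : X → Bool} {x y : X} {p : T (b x)} {q : T (b y)} →
            x ≡ y → _≡_ {A = Subtype b} (x , p) (y , q)
subtype-≡ refl = cong (_ ,_) (T-irrelevant _ _)

T-and-T-not : ∀ {b} → T b → T (not b) → ⊥
T-and-T-not {true} _ ()

subtype-∨-↔ : {X : Set} {b c d : X → Bool} → (∀ x → b x ≡ c x ∨ d x) →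
              (∀ x → T (c x) → T (d x) → ⊥) → Subtype b ↔ (Subtype c ⊎ Subtype d)
subtype-∨-↔ {X} {b} {c} {d} b≡c∨d disjoint = mk↔ₛ′ to from to∘from from∘to
  where
  split : ∀ x → T (b x) → T (c x) ⊎ T (d x)
  split x p = Equivalence.to T-∨ (subst T (b≡c∨d x) p)
  join : ∀ x → T (c x) ⊎ T (d x) → T (b x)
  join x q = subst T (sym (b≡c∨d x)) (Equivalence.from T-∨ q)
  tag : ∀ x → T (c x) ⊎ T (d x) → Subtype c ⊎ Subtype d
  tag x = Sum.map (x ,_) (x ,_)
  to : Subtype b → Subtype c ⊎ Subtype d
  to (x , p) = tag x (split x p)
  from : Subtype c ⊎ Subtype d → Subtype b
  from (inj₁ (x , q)) = x , join x (inj₁ q)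
  from (inj₂ (x , r)) = x , join x (inj₂ r)
  tag-left : ∀ {x} (q : T (c x)) s → tag x s ≡ inj₁ (x , q)
  tag-left q (inj₁ _) = cong inj₁ (subtype-≡ refl)
  tag-left q (inj₂ r) = ⊥-elim (disjoint _ q r)
  tag-right : ∀ {x} (r : T (d x)) s → tag x s ≡ inj₂ (x , r)
  tag-right r (inj₁ q) = ⊥-elim (disjoint _ q r)
  tag-right r (inj₂ _) = cong inj₂ (subtype-≡ refl)
  to∘from : ∀ y → to (from y) ≡ y
  to∘from (inj₁ (x , q)) = tag-left q (split x (join x (inj₁ q)))
  to∘from (inj₂ (x , r)) = tag-right r (split x (join x (inj₂ r)))
  from∘to : ∀ y → from (to y) ≡ y
  from∘to (x , p) with split x p
  ... | inj₁ _ = subtype-≡ refl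
  ... | inj₂ _ = subtype-≡ refl

↔-subtype-⊎-complement : {X : Set} (b : X → Bool) → X ↔ (Subtype b ⊎ Subtype (not ∘ b))
↔-subtype-⊎-complement b =
  ↔-trans (mk↔ₛ′ (_, tt) proj₁ (λ _ → refl) (λ _ → refl))
          (subtype-∨-↔ (λ x → sym (∨-inverseʳ (b x))) (λ x → T-and-T-not))

finite-↔ : {X Y : Set} → X ↔ Y → Finite X → Finite Y
finite-↔ e (n , f) = n , ↔-trans (↔-sym e) f

finite-⊎ : {X Y : Set} → Finite X → Finite Y → Finite (X ⊎ Y)
finite-⊎ (m , f) (n , g) = m + n , ↔-trans (f ⊎-↔ g) (↔-sym +↔⊎)

empty-↔ : {X Y : Set} → (X → ⊥) → (Y → ⊥) → X ↔ Y
empty-↔ ¬x ¬y = mk↔ₛ′ (⊥-elim ∘ ¬x) (⊥-elim ∘ ¬y) (⊥-elim ∘ ¬y) (⊥-elim ∘ ¬x)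

finite-empty : {X : Set} → (X → ⊥) → Finite X
finite-empty ¬x = 0 , empty-↔ ¬x (λ ())

finite-T : ∀ b → Finite (T b)
finite-T true  = 1 , ↔-sym 1↔⊤
finite-T false = finite-empty (λ ())

finite-subtype-Fin : ∀ n (c : Fin n → Bool) → Finite (Subtype c)
finite-subtype-Fin zero    c = finite-empty (λ ())
finite-subtype-Fin (suc n) c =
  finite-↔ (↔-sym split-zero)
    (finite-⊎ (finite-T (c Fin.zero)) (finite-subtype-Fin n (c ∘ Fin.suc)))
  where
  split-zero : Subtype c ↔ (T (c Fin.zero) ⊎ Subtype (c ∘ Fin.suc))
  split-zero = mk↔ₛ′ (λ { (Fin.zero , p) → inj₁ p ; (Fin.suc i , p) → inj₂ (i , p) })
                     [ (Fin.zero ,_) , (λ (i , p) → Fin.suc i , p) ]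
                     (λ { (inj₁ p) → refl ; (inj₂ _) → refl })
                     (λ { (Fin.zero , _) → refl ; (Fin.suc _ , _) → refl })

finite-subtype : {X : Set} → Finite X → (b : X → Bool) → Finite (Subtype b)
finite-subtype (n , e) b =
  finite-↔ (Σ-↔ (↔-sym e) ↔-refl) (finite-subtype-Fin n (b ∘ Inverse.from e))

⊎-cancelʳ-↔ : {A B C : Set} → Finite A → Finite B → Finite C →
              (A ⊎ B) ↔ (C ⊎ B) → A ↔ C
⊎-cancelʳ-↔ (a , eA) (b , eB) (c , eC) e =
  ↔-trans eA (subst (λ k → Fin k ↔ _) (sym a≡c) (↔-sym eC))
  where
  a≡c : a ≡ c
  a≡c = +-cancelʳ-≡ b a c (↔⇒≡ (↔-trans (↔-sym (↔-trans (eA ⊎-↔ eB) (↔-sym +↔⊎)))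
                                         (↔-trans e (↔-trans (eC ⊎-↔ eB) (↔-sym +↔⊎)))))

complement-cancel : {X : Set} → Finite X → (b c : X → Bool) →
                    Subtype (not ∘ b) ↔ Subtype (not ∘ c) → Subtype b ↔ Subtype c
complement-cancel fX b c e =
  ⊎-cancelʳ-↔ (finite-subtype fX b) (finite-subtype fX (not ∘ b)) (finite-subtype fX c)
    (↔-trans (↔-sym (↔-subtype-⊎-complement b))
      (↔-trans (↔-subtype-⊎-complement c) (↔-refl ⊎-↔ ↔-sym e)))

-- Partitions and their finiteness

Partitions : (n : ℕ) → (Partition n → Bool) → Set
Partitions n = Subtype {Partition n}

partition-≡ : ∀ {n} {π σ : Partition n} → parts π ≡ parts σ → π ≡ σ
partition-≡ {π = mkPartition ps s p e} {mkPartition .ps s′ p′ e′} refl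
  rewrite Linked.irrelevant ≤-irrelevant s s′ | All.irrelevant <-irrelevant p p′ | ≡-irrelevant e e′
  = refl

partitions-≡ : ∀ {n b} {x y : Partitions n b} → parts (proj₁ x) ≡ parts (proj₁ y) → x ≡ y
partitions-≡ e = subtype-≡ (partition-≡ e)

≤-head : ∀ {x xs} → Linked _≥_ (x ∷ xs) → All (_≤ x) xs
≤-head [-]       = []
≤-head (x≥y ∷ l) = Linked⇒All (λ i≥j j≥k → ≤-trans j≥k i≥j) x≥y l

∷-sorted : ∀ {x xs} → All (_≤ x) xs → Linked _≥_ xs → Linked _≥_ (x ∷ xs)
∷-sorted []        _ = [-]
∷-sorted (y≤x ∷ _) l = y≤x ∷ l

largestPart-≤ : ∀ {B} xs → All (_≤ B) xs → largestPart xs ≤ B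
largestPart-≤ []       []             = z≤n
largestPart-≤ (x ∷ xs) (x≤B ∷ xs≤B) = ⊔-lub x≤B (largestPart-≤ xs xs≤B)

≤-largestPart : ∀ xs → All (_≤ largestPart xs) xs
≤-largestPart []       = []
≤-largestPart (x ∷ xs) =
  m≤m⊔n x _ ∷ All.map (λ y≤ → ≤-trans y≤ (m≤n⊔m x _)) (≤-largestPart xs)

largestPart-sorted : ∀ {x xs} → Linked _≥_ (x ∷ xs) → largestPart (x ∷ xs) ≡ x
largestPart-sorted l = m≥n⇒m⊔n≡m (largestPart-≤ _ (≤-head l))

largestPart≤sum : ∀ xs → largestPart xs ≤ sum xs
largestPart≤sum []       = z≤n
largestPart≤sum (x ∷ xs) = ⊔-lub (m≤m+n x _) (≤-trans (largestPart≤sum xs) (m≤n+m _ x))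

largestPart≤size : ∀ {n} (π : Partition n) → largestPart (parts π) ≤ n
largestPart≤size π = subst (largestPart (parts π) ≤_) (sums π) (largestPart≤sum (parts π))

atMost : ℕ → ∀ {n} → Partition n → Bool
atMost m π = largestPart (parts π) ≤ᵇ m

exactly : ℕ → ∀ {n} → Partition n → Bool
exactly m π = largestPart (parts π) ≡ᵇ m

≤ᵇ-suc : ∀ x m → (x ≤ᵇ suc m) ≡ (x ≤ᵇ m) ∨ (x ≡ᵇ suc m)
≤ᵇ-suc zero             m       = refl
≤ᵇ-suc (suc zero)       zero    = refl
≤ᵇ-suc (suc (suc x))    zero    = refl
≤ᵇ-suc (suc zero)       (suc m) = refl
≤ᵇ-suc (suc (suc x))    (suc m) = ≤ᵇ-suc (suc x) m

atMost-suc-↔ : ∀ n m → Partitions n (atMost (suc m)) ↔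
                       (Partitions n (atMost m) ⊎ Partitions n (exactly (suc m)))
atMost-suc-↔ n m = subtype-∨-↔ (λ π → ≤ᵇ-suc (largestPart (parts π)) m) disjoint
  where
  disjoint : (π : Partition n) → T (atMost m π) → T (exactly (suc m) π) → ⊥
  disjoint π ≤m ≡sm = 1+n≰n (subst (_≤ m) (≡ᵇ⇒≡ L (suc m) ≡sm) (≤ᵇ⇒≤ L m ≤m))
    where L = largestPart (parts π)

remove-largest-↔ : ∀ m r →
                   Partitions (suc m + r) (exactly (suc m)) ↔ Partitions r (atMost (suc m))
remove-largest-↔ m r = mk↔ₛ′ to from (λ _ → partitions-≡ refl) from∘to
  where
  head≡ : ∀ {x xs} → Linked _≥_ (x ∷ xs) → T (largestPart (x ∷ xs) ≡ᵇ suc m) → x ≡ suc m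
  head≡ {x} {xs} s p =
    trans (sym (largestPart-sorted s)) (≡ᵇ⇒≡ (largestPart (x ∷ xs)) (suc m) p)
  to : Partitions (suc m + r) (exactly (suc m)) → Partitions r (atMost (suc m))
  to (mkPartition [] _ _ () , _)
  to (mkPartition (x ∷ xs) s pos e , p) =
    mkPartition xs (Linked.tail s) (All.tail pos)
      (+-cancelˡ-≡ (suc m) _ _ (subst (λ y → y + sum xs ≡ suc m + r) (head≡ s p) e)) ,
    ≤⇒≤ᵇ (subst (largestPart xs ≤_) (head≡ s p) (largestPart-≤ xs (≤-head s)))
  from : Partitions r (atMost (suc m)) → Partitions (suc m + r) (exactly (suc m))
  from (σ , q) =
    mkPartition (suc m ∷ parts σ) s (s≤s z≤n ∷ positive σ) (cong (_+_ (suc m)) (sums σ)) ,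
    ≡⇒≡ᵇ _ (suc m) (largestPart-sorted s)
    where
    s = ∷-sorted (All.map (λ y≤ → ≤-trans y≤ (≤ᵇ⇒≤ _ (suc m) q)) (≤-largestPart (parts σ)))
                 (nonincr σ)
  from∘to : ∀ y → from (to y) ≡ y
  from∘to (mkPartition [] _ _ () , _)
  from∘to (mkPartition (x ∷ xs) s _ _ , p) = partitions-≡ (cong (_∷ xs) (sym (head≡ s p)))

parts-of-0≡[] : (π : Partition 0) → parts π ≡ []
parts-of-0≡[] (mkPartition []           _ _          _)  = refl
parts-of-0≡[] (mkPartition (zero ∷ _)   _ (() ∷ _)   _)
parts-of-0≡[] (mkPartition (suc _ ∷ _)  _ _          ())

finite-atMost : ∀ n m → Finite (Partitions n (atMost m))
finite-atMost = <-rec (λ n → ∀ m → Finite (Partitions n (atMost m))) step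
  where
  step : ∀ n → (∀ {r} → r < n → ∀ m → Finite (Partitions r (atMost m))) →
         ∀ m → Finite (Partitions n (atMost m))
  step zero    _   zero    =
    1 , mk↔ₛ′ (λ _ → Fin.zero) (λ _ → mkPartition [] [] [] refl , tt)
              (λ { Fin.zero → refl ; (Fin.suc ()) }) (λ (π , _) → partitions-≡ (sym (parts-of-0≡[] π)))
  step (suc n) _   zero    = finite-empty no-part
    where
    no-part : Partitions (suc n) (atMost 0) → ⊥
    no-part (mkPartition []       _ _         () , _)
    no-part (mkPartition (x ∷ xs) _ (0<x ∷ _) _  , p) =
      1+n≰n (≤-trans 0<x (≤-trans (All.head (≤-largestPart (x ∷ xs))) (≤ᵇ⇒≤ _ 0 p)))
  step n       rec (suc m) =
    finite-↔ (↔-sym (atMost-suc-↔ n m)) (finite-⊎ (step n rec m) finite-exactly)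
    where
    finite-exactly : Finite (Partitions n (exactly (suc m)))
    finite-exactly with suc m ≤? n
    ... | no  n<sm = finite-empty λ (π , p) →
            n<sm (subst (_≤ n) (≡ᵇ⇒≡ (largestPart (parts π)) (suc m) p) (largestPart≤size π))
    ... | yes sm≤n with r , refl ← m≤n⇒∃[o]m+o≡n sm≤n =
            finite-↔ (↔-sym (remove-largest-↔ m r)) (rec (s≤s (m≤n+m r m)) (suc m))

finite-Partition : ∀ n → Finite (Partition n)
finite-Partition n = finite-↔ (↔-sym bounded) (finite-atMost n n)
  where
  bounded : Partition n ↔ Partitions n (atMost n)
  bounded = mk↔ₛ′ (λ π → π , ≤⇒≤ᵇ (largestPart≤size π))
                  proj₁ (λ _ → subtype-≡ refl) (λ _ → refl)

-- Sorted insertion and deletion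

insert : ℕ → List ℕ → List ℕ
insert a []       = a ∷ []
insert a (y ∷ ys) with y ≤? a
... | yes _ = a ∷ y ∷ ys
... | no  _ = y ∷ insert a ys

delete : ℕ → List ℕ → List ℕ
delete a []       = []
delete a (y ∷ ys) with a ≟ y
... | yes _ = ys
... | no  _ = y ∷ delete a ys

insert-↭ : ∀ a ys → insert a ys ↭ a ∷ ys
insert-↭ a []       = ↭-refl
insert-↭ a (y ∷ ys) with y ≤? a
... | yes _ = ↭-refl
... | no  _ = ↭-trans (↭-prep y (insert-↭ a ys)) (↭-swap y a ↭-refl)

insert-All : ∀ {P : ℕ → Set} {a ys} → P a → All P ys → All P (insert a ys)
insert-All {a = a} {ys} pa pys = All-resp-↭ (↭-sym (insert-↭ a ys)) (pa ∷ pys)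

insert-sorted : ∀ a {ys} → Linked _≥_ ys → Linked _≥_ (insert a ys)
insert-sorted a {[]}     _ = [-]
insert-sorted a {y ∷ ys} s with y ≤? a
... | yes y≤a = y≤a ∷ s
... | no  y≰a =
  ∷-sorted (insert-All (<⇒≤ (≰⇒> y≰a)) (≤-head s)) (insert-sorted a (Linked.tail s))

insert-head : ∀ a ys → All (_≤ a) ys → insert a ys ≡ a ∷ ys
insert-head a []       _           = refl
insert-head a (y ∷ ys) (y≤a ∷ _) with y ≤? a
... | yes _   = refl
... | no  y≰a = contradiction y≤a y≰a

delete-All : ∀ {P : ℕ → Set} a {ys} → All P ys → All P (delete a ys)
delete-All a {[]}     []         = []
delete-All a {y ∷ ys} (py ∷ pys) with a ≟ y
... | yes _ = pys
... | no  _ = py ∷ delete-All a pys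

delete-sorted : ∀ a {ys} → Linked _≥_ ys → Linked _≥_ (delete a ys)
delete-sorted a {[]}     s = s
delete-sorted a {y ∷ ys} s with a ≟ y
... | yes _ = Linked.tail s
... | no  _ = ∷-sorted (delete-All a (≤-head s)) (delete-sorted a (Linked.tail s))

delete-insert : ∀ a ys → delete a (insert a ys) ≡ ys
delete-insert a []       with a ≟ a
... | yes _   = refl
... | no  a≢a = contradiction refl a≢a
delete-insert a (y ∷ ys) with y ≤? a
... | yes _ with a ≟ a
...   | yes _   = refl
...   | no  a≢a = contradiction refl a≢a
delete-insert a (y ∷ ys) | no y≰a with a ≟ y
...   | yes refl = contradiction ≤-refl y≰a
...   | no  _    = cong (y ∷_) (delete-insert a ys)

insert-delete : ∀ {a ys} → Linked _≥_ ys → a ∈ ys → insert a (delete a ys) ≡ ys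
insert-delete {a} {y ∷ ys} s a∈ with a ≟ y
... | yes refl = insert-head a ys (≤-head s)
... | no  a≢y with a∈
...   | here a≡y = contradiction a≡y a≢y
...   | there a∈ys with y ≤? a
...     | yes y≤a = contradiction (≤-antisym (All.lookup (≤-head s) a∈ys) y≤a) a≢y
...     | no  _   = cong (y ∷_) (insert-delete (Linked.tail s) a∈ys)

sum-insert : ∀ a ys → sum (insert a ys) ≡ a + sum ys
sum-insert a ys = sum-↭ (insert-↭ a ys)

length-insert : ∀ a ys → length (insert a ys) ≡ suc (length ys)
length-insert a ys = ↭-length (insert-↭ a ys)

∈-insert⁺ : ∀ {x} a ys → x ∈ ys → x ∈ insert a ys
∈-insert⁺ a ys x∈ = ∈-resp-↭ (↭-sym (insert-↭ a ys)) (there x∈)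

∈-insert⁻ : ∀ {x} a ys → x ≢ a → x ∈ insert a ys → x ∈ ys
∈-insert⁻ a ys x≢a x∈ with ∈-resp-↭ (insert-↭ a ys) x∈
... | here  x≡a  = contradiction x≡a x≢a
... | there x∈ys = x∈ys

-- The mex index

_∈ᵇ_ : ℕ → List ℕ → Bool
x ∈ᵇ ps = does (x ∈? ps)

mexIndex : ℕ → ℕ → List ℕ → ℕ
mexIndex A a ps = mexIdxFrom (suc (length ps)) 0 A a ps

mexIdxFrom-present : ∀ f k A a ps → (a + k * A) ∈ ps →
                     mexIdxFrom (suc f) k A a ps ≡ mexIdxFrom f (suc k) A a ps
mexIdxFrom-present f k A a ps p rewrite dec-true ((a + k * A) ∈? ps) p = refl

mexIdxFrom-absent : ∀ f k A a ps → (a + k * A) ∉ ps → mexIdxFrom (suc f) k A a ps ≡ k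
mexIdxFrom-absent f k A a ps p rewrite dec-false ((a + k * A) ∈? ps) p = refl

mexIdxFrom-suc : ∀ f k A a ps → mexIdxFrom f (suc k) A a ps ≡ suc (mexIdxFrom f k A (a + A) ps)
mexIdxFrom-suc zero    k A a ps = refl
mexIdxFrom-suc (suc f) k A a ps rewrite sym (+-assoc a A (k * A)) with (a + A + k * A) ∈ᵇ ps
... | true  = mexIdxFrom-suc f (suc k) A a ps
... | false = refl

mexIdxFrom-cong : ∀ f k A a {ps qs} → (∀ x → a ≤ x → x ∈ᵇ ps ≡ x ∈ᵇ qs) →
                  mexIdxFrom f k A a ps ≡ mexIdxFrom f k A a qs
mexIdxFrom-cong zero    k A a         _  = refl
mexIdxFrom-cong (suc f) k A a {ps} {qs} eq
  rewrite eq (a + k * A) (m≤m+n a _) with (a + k * A) ∈ᵇ qs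
... | true  = mexIdxFrom-cong f (suc k) A a eq
... | false = refl

mexIndex-insert : ∀ A a ys → 0 < A → mexIndex A a (insert a ys) ≡ suc (mexIndex A (a + A) ys)
mexIndex-insert A a ys 0<A = begin
  mexIdxFrom (suc (length (insert a ys))) 0 A a (insert a ys)
    ≡⟨ cong (λ l → mexIdxFrom (suc l) 0 A a (insert a ys)) (length-insert a ys) ⟩
  mexIdxFrom (suc (suc (length ys))) 0 A a (insert a ys)
    ≡⟨ mexIdxFrom-present (suc (length ys)) 0 A a (insert a ys) a∈ ⟩
  mexIdxFrom (suc (length ys)) 1 A a (insert a ys)
    ≡⟨ mexIdxFrom-suc (suc (length ys)) 0 A a (insert a ys) ⟩
  suc (mexIdxFrom (suc (length ys)) 0 A (a + A) (insert a ys))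
    ≡⟨ cong suc (mexIdxFrom-cong (suc (length ys)) 0 A (a + A) same-above) ⟩
  suc (mexIdxFrom (suc (length ys)) 0 A (a + A) ys) ∎
  where
  open ≡-Reasoning
  a∈ : (a + 0 * A) ∈ insert a ys
  a∈ rewrite +-identityʳ a = ∈-resp-↭ (↭-sym (insert-↭ a ys)) (here refl)
  same-above : ∀ x → a + A ≤ x → x ∈ᵇ insert a ys ≡ x ∈ᵇ ys
  same-above x a+A≤x =
    does-⇔ (mk⇔ (∈-insert⁻ a ys x≢a) (∈-insert⁺ a ys)) (x ∈? insert a ys) (x ∈? ys)
    where
    x≢a : x ≢ a
    x≢a refl = <-irrefl refl (<-≤-trans (m<m+n a 0<A) a+A≤x)

even : ℕ → Bool
even zero    = true
even (suc n) = not (even n)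

evenMex : ℕ → ℕ → ∀ {n} → Partition n → Bool
evenMex A a π = even (mexIndex A a (parts π))

odd-mexIndex⇒∈ : ∀ A a ps → T (not (even (mexIndex A a ps))) → a ∈ ps
odd-mexIndex⇒∈ A a ps odd with a ∈? ps
... | yes a∈ = a∈
... | no  a∉ =
  ⊥-elim (subst (T ∘ not ∘ even) (mexIdxFrom-absent (length ps) 0 A a ps a+0∉) odd)
  where
  a+0∉ : (a + 0 * A) ∉ ps
  a+0∉ rewrite +-identityʳ a = a∉

-- a is the first candidate for the mex, so deleting a part a leaves the candidates
-- a + A, a + 2A, … and lowers the mex index by one.
remove-mex-part-↔ : ∀ A a r → 0 < A → 0 < a →
                    Partitions (a + r) (not ∘ evenMex A a) ↔ Partitions r (evenMex A (a + A))
remove-mex-part-↔ A a r 0<A 0<a = mk↔ₛ′ to from to∘from from∘to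
  where
  parity-insert : ∀ ys → not (even (mexIndex A a (insert a ys))) ≡ even (mexIndex A (a + A) ys)
  parity-insert ys rewrite mexIndex-insert A a ys 0<A = not-involutive _
  to : Partitions (a + r) (not ∘ evenMex A a) → Partitions r (evenMex A (a + A))
  to (mkPartition ps s pos e , odd) =
    mkPartition (delete a ps) (delete-sorted a s) (delete-All a pos)
      (+-cancelˡ-≡ a _ _ (begin
        a + sum (delete a ps)      ≡⟨ sum-insert a (delete a ps) ⟨
        sum (insert a (delete a ps)) ≡⟨ cong sum ps≡ ⟩
        sum ps                     ≡⟨ e ⟩
        a + r                      ∎)) ,
    subst T (parity-insert (delete a ps)) (subst (T ∘ not ∘ even ∘ mexIndex A a) (sym ps≡) odd)
    where
    open ≡-Reasoning
    ps≡ : insert a (delete a ps) ≡ ps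
    ps≡ = insert-delete s (odd-mexIndex⇒∈ A a ps odd)
  from : Partitions r (evenMex A (a + A)) → Partitions (a + r) (not ∘ evenMex A a)
  from (mkPartition ys s pos e , ev) =
    mkPartition (insert a ys) (insert-sorted a s) (insert-All 0<a pos)
      (trans (sum-insert a ys) (cong (_+_ a) e)) ,
    subst T (sym (parity-insert ys)) ev
  to∘from : ∀ y → to (from y) ≡ y
  to∘from (σ , _) = partitions-≡ (delete-insert a (parts σ))
  from∘to : ∀ y → from (to y) ≡ y
  from∘to (mkPartition ps s _ _ , odd) =
    partitions-≡ (insert-delete s (odd-mexIndex⇒∈ A a ps odd))

-- First columns

addColumn : ℕ → List ℕ → List ℕ
addColumn c xs = map suc xs ++ replicate c 1

removeColumn : List ℕ → List ℕ
removeColumn ys = filter (0 <?_) (map pred ys)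

length-addColumn : ∀ c xs → length (addColumn c xs) ≡ length xs + c
length-addColumn c xs =
  trans (length-++ (map suc xs)) (cong₂ _+_ (length-map suc xs) (length-replicate c))

length-removeColumn : ∀ ys → length (removeColumn ys) ≤ length ys
length-removeColumn ys =
  ≤-trans (length-filter (0 <?_) (map pred ys)) (≤-reflexive (length-map pred ys))

sum-addColumn : ∀ c xs → sum (addColumn c xs) ≡ (length xs + sum xs) + c
sum-addColumn c xs =
  trans (sum-++ (map suc xs) (replicate c 1)) (cong₂ _+_ (sum-map-suc xs) (sum-ones c))
  where
  sum-map-suc : ∀ xs → sum (map suc xs) ≡ length xs + sum xs
  sum-map-suc []       = refl
  sum-map-suc (x ∷ xs) =
    cong suc (trans (cong (_+_ x) (sum-map-suc xs)) (swap x (length xs) (sum xs)))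
    where
    swap : ∀ x l s → x + (l + s) ≡ l + (x + s)
    swap = solve-∀
  sum-ones : ∀ c → sum (replicate c 1) ≡ c
  sum-ones zero    = refl
  sum-ones (suc c) = cong suc (sum-ones c)

sum-removeColumn : ∀ {ys} → All (0 <_) ys → sum (removeColumn ys) + length ys ≡ sum ys
sum-removeColumn {ys} pos =
  trans (cong (_+ length ys) (sum-positives (map pred ys))) (sum-map-pred pos)
  where
  sum-positives : ∀ zs → sum (filter (0 <?_) zs) ≡ sum zs
  sum-positives []           = refl
  sum-positives (zero  ∷ zs) = sum-positives zs
  sum-positives (suc z ∷ zs) = cong (_+_ (suc z)) (sum-positives zs)
  sum-map-pred : ∀ {ys} → All (0 <_) ys → sum (map pred ys) + length ys ≡ sum ys
  sum-map-pred []                     = refl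
  sum-map-pred {suc y ∷ ys} (_ ∷ pos) =
    trans (shift y (sum (map pred ys)) (length ys)) (cong (_+_ (suc y)) (sum-map-pred pos))
    where
    shift : ∀ y s l → (y + s) + suc l ≡ suc y + (s + l)
    shift = solve-∀

removeColumn-addColumn : ∀ c {xs} → All (0 <_) xs → removeColumn (addColumn c xs) ≡ xs
removeColumn-addColumn c {xs} pos = begin
  filter (0 <?_) (map pred (map suc xs ++ replicate c 1))
    ≡⟨ cong (filter (0 <?_)) (map-++ pred (map suc xs) (replicate c 1)) ⟩
  filter (0 <?_) (map pred (map suc xs) ++ map pred (replicate c 1))
    ≡⟨ cong₂ (λ us vs → filter (0 <?_) (us ++ vs)) (map-pred-suc xs) (map-replicate pred c 1) ⟩
  filter (0 <?_) (xs ++ replicate c 0)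
    ≡⟨ filter-++ (0 <?_) xs (replicate c 0) ⟩
  filter (0 <?_) xs ++ filter (0 <?_) (replicate c 0)
    ≡⟨ cong₂ _++_ (filter-all (0 <?_) pos) (filter-none (0 <?_) (replicate⁺ c (λ ()))) ⟩
  xs ++ [] ≡⟨ ++-identityʳ xs ⟩
  xs ∎
  where
  open ≡-Reasoning
  map-pred-suc : ∀ xs → map pred (map suc xs) ≡ xs
  map-pred-suc xs = trans (sym (map-∘ xs)) (map-id xs)

all-ones : ∀ {ys} → All (_≤ 1) ys → All (0 <_) ys → ys ≡ replicate (length ys) 1
all-ones {[]}           []        []       = refl
all-ones {suc zero ∷ _} (_ ∷ ≤1) (_ ∷ pos) = cong (1 ∷_) (all-ones ≤1 pos)
all-ones {suc (suc _) ∷ _} (s≤s () ∷ _) _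

removeColumn-ones : ∀ c → removeColumn (replicate c 1) ≡ []
removeColumn-ones zero    = refl
removeColumn-ones (suc c) = removeColumn-ones c

addColumn-removeColumn : ∀ {ys} → Linked _≥_ ys → All (0 <_) ys →
                         addColumn (length ys ∸ length (removeColumn ys)) (removeColumn ys) ≡ ys
addColumn-removeColumn {[]}               _ _         = refl
addColumn-removeColumn {suc zero ∷ ys}    s (_ ∷ pos)
  rewrite all-ones (≤-head s) pos | removeColumn-ones (length ys) =
  cong (λ l → 1 ∷ replicate l 1) (length-replicate (length ys))
addColumn-removeColumn {suc (suc y) ∷ ys} s (_ ∷ pos) =
  cong (suc (suc y) ∷_) (addColumn-removeColumn (Linked.tail s) pos)

ones-sorted : ∀ c → Linked _≥_ (replicate c 1)
ones-sorted zero    = []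
ones-sorted (suc c) = ∷-sorted (replicate⁺ c ≤-refl) (ones-sorted c)

++-ones-sorted : ∀ c {xs} → Linked _≥_ xs → All (0 <_) xs → Linked _≥_ (xs ++ replicate c 1)
++-ones-sorted c {[]}     _ _           = ones-sorted c
++-ones-sorted c {x ∷ xs} s (0<x ∷ pos) =
  ∷-sorted (All.++⁺ (≤-head s) (replicate⁺ c 0<x)) (++-ones-sorted c (Linked.tail s) pos)

addColumn-sorted : ∀ c {xs} → Linked _≥_ xs → Linked _≥_ (addColumn c xs)
addColumn-sorted c {xs} s =
  ++-ones-sorted c (Linked.map⁺ (Linked.map s≤s s)) (All.map⁺ (All.universal (λ _ → s≤s z≤n) xs))

addColumn-positive : ∀ c xs → All (0 <_) (addColumn c xs)
addColumn-positive c xs =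
  All.++⁺ (All.map⁺ (All.universal (λ _ → s≤s z≤n) xs)) (replicate⁺ c ≤-refl)

addColumn-≤ : ∀ c {B xs} → All (_≤ B) xs → All (_≤ suc B) (addColumn c xs)
addColumn-≤ c ≤B = All.++⁺ (All.map⁺ (All.map s≤s ≤B)) (replicate⁺ c (s≤s z≤n))

removeColumn-sorted : ∀ {ys} → Linked _≥_ ys → Linked _≥_ (removeColumn ys)
removeColumn-sorted s =
  Linked.filter⁺ (0 <?_) (λ i≥j j≥k → ≤-trans j≥k i≥j) (Linked.map⁺ (Linked.map pred-mono-≤ s))

removeColumn-positive : ∀ ys → All (0 <_) (removeColumn ys)
removeColumn-positive ys = All.all-filter (0 <?_) (map pred ys)

removeColumn-≤ : ∀ {B ys} → All (_≤ suc B) ys → All (_≤ B) (removeColumn ys)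
removeColumn-≤ ≤sB = All.filter⁺ (0 <?_) (All.map⁺ (All.map pred-mono-≤ ≤sB))

-- The rank bijection and the induction

rankBelow : ℕ → ∀ {n} → Partition n → Bool
rankBelow j π = ⌊ largestPart (parts π) <? length (parts π) + j ⌋

rankBelow⇒< : ∀ j xs → T ⌊ largestPart xs <? length xs + j ⌋ → largestPart xs < length xs + j
rankBelow⇒< j xs = toWitness {a? = largestPart xs <? length xs + j}

<⇒rankBelow : ∀ j xs → largestPart xs < length xs + j → T ⌊ largestPart xs <? length xs + j ⌋
<⇒rankBelow j xs = fromWitness {a? = largestPart xs <? length xs + j}

¬rankBelow⇒≥ : ∀ j xs → T (not ⌊ largestPart xs <? length xs + j ⌋) → length xs + j ≤ largestPart xs
¬rankBelow⇒≥ j xs p = ≮⇒≥ (toWitnessFalse {a? = largestPart xs <? length xs + j} p)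

≥⇒¬rankBelow : ∀ j xs → length xs + j ≤ largestPart xs → T (not ⌊ largestPart xs <? length xs + j ⌋)
≥⇒¬rankBelow j xs ≥ = fromWitnessFalse {a? = largestPart xs <? length xs + j} (≤⇒≯ ≥)

surplus : ℕ → ℕ → List ℕ → ℕ
surplus j x xs = x ∸ (suc j + length xs)

surplus-≡ : ∀ j {x xs} → Linked _≥_ (x ∷ xs) →
            T (not ⌊ largestPart (x ∷ xs) <? length (x ∷ xs) + j ⌋) →
            suc j + length xs + surplus j x xs ≡ x
surplus-≡ j {x} {xs} s p = m+[n∸m]≡n
  (subst₂ _≤_ (cong suc (+-comm (length xs) j)) (largestPart-sorted s) (¬rankBelow⇒≥ j (x ∷ xs) p))

-- Replaces the largest part x by a first column of height x − j − 1: the largest part grows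
-- by at most one while there are now x − j − 1 parts, so the rank is at most j + 2.
largestToColumn : ∀ j r →
                  Partitions (suc j + r) (not ∘ rankBelow j) → Partitions r (rankBelow (j + 3))
largestToColumn j r (mkPartition []       _ _   () , _)
largestToColumn j r (mkPartition (x ∷ xs) s pos e  , p) =
  mkPartition (addColumn c xs) (addColumn-sorted c (Linked.tail s)) (addColumn-positive c xs) sum≡ ,
  <⇒rankBelow (j + 3) (addColumn c xs) below
  where
  open ≤-Reasoning
  c = surplus j x xs
  x≡ = surplus-≡ j s p
  sum≡ : sum (addColumn c xs) ≡ r
  sum≡ = +-cancelˡ-≡ (suc j) _ _ (begin-equality
    suc j + sum (addColumn c xs)        ≡⟨ cong (_+_ (suc j)) (sum-addColumn c xs) ⟩
    suc j + ((length xs + sum xs) + c)  ≡⟨ rearrange (suc j) (length xs) (sum xs) c ⟩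
    (suc j + length xs + c) + sum xs    ≡⟨ cong (_+ sum xs) x≡ ⟩
    x + sum xs                          ≡⟨ e ⟩
    suc j + r                           ∎)
    where
    rearrange : ∀ a l s c → a + ((l + s) + c) ≡ (a + l + c) + s
    rearrange = solve-∀
  below : largestPart (addColumn c xs) < length (addColumn c xs) + (j + 3)
  below = begin-strict
    largestPart (addColumn c xs)       ≤⟨ largestPart-≤ _ (addColumn-≤ c (≤-head s)) ⟩
    suc x                              ≡⟨ cong suc x≡ ⟨
    suc (suc j + length xs + c)        <⟨ ≤-reflexive (shift j (length xs) c) ⟩
    (length xs + c) + (j + 3)          ≡⟨ cong (_+ (j + 3)) (length-addColumn c xs) ⟨
    length (addColumn c xs) + (j + 3)  ∎
    where
    shift : ∀ j l c → suc (suc (suc j + l + c)) ≡ (l + c) + (j + 3)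
    shift = solve-∀

columnToLargest : ∀ j r →
                  Partitions r (rankBelow (j + 3)) → Partitions (suc j + r) (not ∘ rankBelow j)
columnToLargest j r (mkPartition ys s pos e , p) =
  mkPartition (y ∷ removeColumn ys) (∷-sorted (removeColumn-≤ ys≤) (removeColumn-sorted s))
    (s≤s z≤n ∷ removeColumn-positive ys) sum≡ ,
  ≥⇒¬rankBelow j (y ∷ removeColumn ys) rank≥j
  where
  open ≤-Reasoning
  y = suc j + length ys
  ys≤ : All (_≤ suc y) ys
  ys≤ = All.map (λ z≤ → ≤-trans z≤ largest≤) (≤-largestPart ys)
    where
    shift : ∀ j l → l + (j + 3) ≡ suc (suc (suc j + l))
    shift = solve-∀
    largest≤ : largestPart ys ≤ suc y
    largest≤ = ≤-pred (≤-trans (rankBelow⇒< (j + 3) ys p) (≤-reflexive (shift j (length ys))))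
  sum≡ : y + sum (removeColumn ys) ≡ suc j + r
  sum≡ = begin-equality
    suc j + length ys + sum (removeColumn ys)    ≡⟨ +-assoc (suc j) (length ys) _ ⟩
    suc j + (length ys + sum (removeColumn ys))  ≡⟨ cong (_+_ (suc j)) (+-comm (length ys) _) ⟩
    suc j + (sum (removeColumn ys) + length ys)  ≡⟨ cong (_+_ (suc j)) (sum-removeColumn pos) ⟩
    suc j + sum ys                               ≡⟨ cong (_+_ (suc j)) e ⟩
    suc j + r                                    ∎
  rank≥j : suc (length (removeColumn ys)) + j ≤ largestPart (y ∷ removeColumn ys)
  rank≥j = begin
    suc (length (removeColumn ys)) + j  ≤⟨ +-monoˡ-≤ j (s≤s (length-removeColumn ys)) ⟩
    suc (length ys) + j                 ≡⟨ cong suc (+-comm (length ys) j) ⟩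
    y                                   ≤⟨ m≤m⊔n y (largestPart (removeColumn ys)) ⟩
    largestPart (y ∷ removeColumn ys)   ∎

rank-shift-↔ : ∀ j r →
               Partitions (suc j + r) (not ∘ rankBelow j) ↔ Partitions r (rankBelow (j + 3))
rank-shift-↔ j r = mk↔ₛ′ (largestToColumn j r) (columnToLargest j r) to∘from from∘to
  where
  to∘from : ∀ σ → largestToColumn j r (columnToLargest j r σ) ≡ σ
  to∘from (mkPartition ys s pos _ , _) = partitions-≡ (trans
    (cong (λ c → addColumn c (removeColumn ys)) ([m+n]∸[m+o]≡n∸o (suc j) (length ys) _))
    (addColumn-removeColumn s pos))
  from∘to : ∀ π → columnToLargest j r (largestToColumn j r π) ≡ π
  from∘to (mkPartition []       _ _   () , _)
  from∘to (mkPartition (x ∷ xs) s pos _  , p) =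
    partitions-≡ (cong₂ _∷_ head≡ (removeColumn-addColumn c (All.tail pos)))
    where
    open ≡-Reasoning
    c = surplus j x xs
    head≡ : suc j + length (addColumn c xs) ≡ x
    head≡ = begin
      suc j + length (addColumn c xs)  ≡⟨ cong (_+_ (suc j)) (length-addColumn c xs) ⟩
      suc j + (length xs + c)          ≡⟨ +-assoc (suc j) (length xs) c ⟨
      suc j + length xs + c            ≡⟨ surplus-≡ j s p ⟩
      x                                ∎

odd-mex⇒≤ : ∀ A a {n} (π : Partition n) → T (not (evenMex A a π)) → a ≤ n
odd-mex⇒≤ A a π odd =
  ≤-trans (All.lookup (≤-largestPart (parts π)) (odd-mexIndex⇒∈ A a (parts π) odd))
          (largestPart≤size π)

¬rank≥-small : ∀ j {n} → n ≤ j → 0 < n ⊎ 0 < j →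
               (π : Partition n) → ¬ T (not (rankBelow j π))
¬rank≥-small j n≤j 0<n⊎0<j (mkPartition [] _ _ refl) p with 0<n⊎0<j
... | inj₁ ()
... | inj₂ 0<j = 1+n≰n (≤-trans 0<j (¬rankBelow⇒≥ j [] p))
¬rank≥-small j {n} n≤j _ π@(mkPartition (x ∷ xs) _ _ _) p = 1+n≰n (begin
  suc j                        ≤⟨ m≤n+m (suc j) (length xs) ⟩
  length xs + suc j            ≡⟨ +-suc (length xs) j ⟩
  length (x ∷ xs) + j          ≤⟨ ¬rankBelow⇒≥ j (x ∷ xs) p ⟩
  largestPart (x ∷ xs)         ≤⟨ largestPart≤size π ⟩
  n                            ≤⟨ n≤j ⟩
  j                            ∎)
  where open ≤-Reasoning

-- The hypothesis excludes n = j = 0, where the empty partition has mex index 0 but rank 0.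
mex-rank-↔ : ∀ n j → 0 < n ⊎ 0 < j →
             Partitions n (evenMex 3 (suc j)) ↔ Partitions n (rankBelow j)
mex-rank-↔ = <-rec P step
  where
  P : ℕ → Set
  P n = ∀ j → 0 < n ⊎ 0 < j → Partitions n (evenMex 3 (suc j)) ↔ Partitions n (rankBelow j)
  step : ∀ n → (∀ {r} → r < n → P r) → P n
  step n rec j 0<n⊎0<j =
    complement-cancel (finite-Partition n) (evenMex 3 (suc j)) (rankBelow j) complements
    where
    complements : Partitions n (not ∘ evenMex 3 (suc j)) ↔ Partitions n (not ∘ rankBelow j)
    complements with suc j ≤? n
    ... | no  n<sj = empty-↔ (λ (π , p) → n<sj (odd-mex⇒≤ 3 (suc j) π p))
                             (λ (π , p) → ¬rank≥-small j (≤-pred (≰⇒> n<sj)) 0<n⊎0<j π p)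
    ... | yes sj≤n with r , refl ← m≤n⇒∃[o]m+o≡n sj≤n =
      ↔-trans (remove-mex-part-↔ 3 (suc j) r (s≤s z≤n) (s≤s z≤n))
        (↔-trans (rec (s≤s (m≤n+m r j)) (j + 3) (inj₂ (≤-trans (s≤s z≤n) (m≤n+m 3 j))))
                 (↔-sym (rank-shift-↔ j r)))

-- Translation to the mex condition and the rank

Σ-↔-subtype : {X : Set} {P : X → Set} {b : X → Bool} → (∀ x → P x ⇔ T (b x)) →
              (∀ x (p q : P x) → p ≡ q) → Σ X P ↔ Subtype b
Σ-↔-subtype P⇔b P-irrelevant = mk↔ₛ′
  (λ (x , p) → x , Equivalence.to (P⇔b x) p) (λ (x , q) → x , Equivalence.from (P⇔b x) q)
  (λ _ → subtype-≡ refl) (λ (x , _) → cong (x ,_) (P-irrelevant x _ _))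

∣-irrelevant : ∀ {d n} .{{_ : NonZero d}} (p q : d ℕ∣ n) → p ≡ q
∣-irrelevant {d} (divides q₁ e₁) (divides q₂ e₂)
  with *-cancelʳ-≡ q₁ q₂ d (trans (sym e₁) e₂)
... | refl = cong (divides q₁) (≡-irrelevant e₁ e₂)

even⇔2∣ : ∀ k → T (even k) ⇔ 2 ℕ∣ k
even⇔2∣ zero          = mk⇔ (λ _ → divides 0 refl) (λ _ → tt)
even⇔2∣ (suc zero)    = mk⇔ (λ ()) (λ 2∣1 → contradiction (∣1⇒≡1 2∣1) λ ())
even⇔2∣ (suc (suc k)) = mk⇔
  (λ ev → ∣m∣n⇒∣m+n (n∣n {2}) (Equivalence.to (even⇔2∣ k) (subst T (not-involutive (even k)) ev)))
  (λ 2∣ → subst T (sym (not-involutive (even k)))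
                  (Equivalence.from (even⇔2∣ k) (∣m+n∣m⇒∣n 2∣ (n∣n {2}))))

+[m+n]-+m≡+n : ∀ m n → + (m + n) - + m ≡ + n
+[m+n]-+m≡+n m n = begin
  + (m + n) - + m    ≡⟨ m-n≡m⊖n (m + n) m ⟩
  (m + n) ⊖ m        ≡⟨ ⊖-≥ (m≤m+n m n) ⟩
  + ((m + n) ∸ m)    ≡⟨ cong +_ (m+n∸m≡n m n) ⟩
  + n                ∎
  where open ≡-Reasoning

m*d∣n*d⇔m∣n : ∀ d .{{_ : NonZero d}} m n → m * d ℕ∣ n * d ⇔ m ℕ∣ n
m*d∣n*d⇔m∣n d m n =
  mk⇔ (λ m*d∣n*d → *-cancelˡ-∣ d (subst₂ _ℕ∣_ (*-comm m d) (*-comm n d) m*d∣n*d)) (*-monoˡ-∣ d)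

mexCond⇔evenMex : ∀ A a .{{_ : NonZero A}} {n} (π : Partition n) →
                  MexCond A a π ⇔ T (evenMex A a π)
mexCond⇔evenMex A a π = mk⇔
  (λ 2A∣ → Equivalence.from (even⇔2∣ k)
             (Equivalence.to (m*d∣n*d⇔m∣n A 2 k) (subst (2 * A ℕ∣_) ∣mex-a∣≡ 2A∣)))
  (λ ev → subst (2 * A ℕ∣_) (sym ∣mex-a∣≡)
            (Equivalence.from (m*d∣n*d⇔m∣n A 2 k) (Equivalence.to (even⇔2∣ k) ev)))
  where
  k = mexIndex A a (parts π)
  ∣mex-a∣≡ : ∣ + mex A a (parts π) - + a ∣ ≡ k * A
  ∣mex-a∣≡ = cong ∣_∣ (+[m+n]-+m≡+n a (k * A))

m⊖n<j⇔m<n+j : ∀ m n j → m ⊖ n <ℤ + j ⇔ m < n + j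
m⊖n<j⇔m<n+j m n j = mk⇔ to from
  where
  [n+j]⊖n≡+j : (n + j) ⊖ n ≡ + j
  [n+j]⊖n≡+j = trans (⊖-≥ (m≤m+n n j)) (cong +_ (m+n∸m≡n n j))
  from : m < n + j → m ⊖ n <ℤ + j
  from m<n+j = subst (m ⊖ n <ℤ_) [n+j]⊖n≡+j (⊖-monoˡ-< n m<n+j)
  to : m ⊖ n <ℤ + j → m < n + j
  to m⊖n<j with m <? n + j
  ... | yes m<n+j = m<n+j
  ... | no  m≮n+j =
    contradiction m⊖n<j (ℤ.≤⇒≯ (subst (_≤ℤ m ⊖ n) [n+j]⊖n≡+j (⊖-monoˡ-≤ n (≮⇒≥ m≮n+j))))

rank<⇔rankBelow : ∀ j {n} (π : Partition n) → rank π <ℤ + j ⇔ T (rankBelow j π)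
rank<⇔rankBelow j π = mk⇔
  (λ r<j → <⇒rankBelow j (parts π)
             (Equivalence.to (m⊖n<j⇔m<n+j L l j) (subst (_<ℤ + j) (m-n≡m⊖n L l) r<j)))
  (λ below → subst (_<ℤ + j) (sym (m-n≡m⊖n L l))
               (Equivalence.from (m⊖n<j⇔m<n+j L l j) (rankBelow⇒< j (parts π) below)))
  where
  L = largestPart (parts π)
  l = length (parts π)

corollary3p5 : (j n : ℕ) → 1 ≤ n →
    Σ (Partition n) (MexCond 3 (suc j)) ↔ Σ (Partition n) (λ π → rank π <ℤ + j)
corollary3p5 j n 1≤n =
  ↔-trans (Σ-↔-subtype (mexCond⇔evenMex 3 (suc j)) (λ _ → ∣-irrelevant))
    (↔-trans (mex-rank-↔ n j (inj₁ 1≤n))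
      (↔-sym (Σ-↔-subtype (rank<⇔rankBelow j) (λ _ → ℤ.<-irrelevant))))
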